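{- Let $a$ be a positive integer and $b$ a non-negative integer, and let $G\in\mathscr{G}_{a,b}$. Let $C=u_1u_2\cdots u_ku_1$ be a cycle of $G$. If $d_{G_0}(u_1)\geq 3$ and $d_{G_0}(u_2)=2$, then there is $i\in\{1,2,\ldots,k\}$ such that $d(u_i)\neq a-b-1$.
   Context: Graphs are finite, simple and connected; $d(v)$ denotes the degree of $v$ in $G$, $N_G(v)$ its neighbourhood, and $s(v)=\sum_{u\in N_G(v)}d(u)$. A graph $G$ is 2-walk $(a,b)$-parabolic if there exist uniquely a positive integer $a$ and a non-negative integer $b$ such that $a^2-8b>0$ and $s(v)=-d(v)^2+a\,d(v)-b$ for all $v\in V(G)$. A bicyclic graph is a simple connected graph with number of edges equal to number of vertices plus one. $\mathscr{G}_{a,b}$ is the set of 2-walk $(a,b)$-parabolic bicyclic graphs $G$ with minimum degree $\delta(G)=1$. For $G\in\mathscr{G}_{a,b}$, $G_0$ denotes the graph obtained from $G$ by deleting all pendant (degree-1) vertices, and $d_{G_0}(v)$ the degree of $v$ in $G_0$. -}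

module Defs where

open import Data.Nat using (ℕ; zero; suc; _+_; _*_; _∸_; _^_; _≤_; _<_)
open import Data.Nat.Properties using (_<?_)
open import Data.Bool using (Bool; true; false; if_then_else_)
open import Data.Fin using (Fin; toℕ)
open import Data.List using (List; map; allFin; concatMap)
open import Data.Nat.ListAction using (sum)
open import Data.Product using (Σ; ∃; ∃-syntax; _×_; _,_)
open import Data.Integer as ℤ using (ℤ; +_)
open import Relation.Nullary using (¬_; does)
open import Relation.Binary.PropositionalEquality using (_≡_)
open import Relation.Binary.Construct.Closure.ReflexiveTransitive using (Star)

record Graph (n : ℕ) : Set where
  field
    adj     : Fin n → Fin n → Bool
    adj-sym : ∀ u v → adj u v ≡ adj v u
    irrefl  : ∀ v → adj v v ≡ false
open Graph public

Adj : ∀ {n} → Graph n → Fin n → Fin n → Set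
Adj G u v = adj G u v ≡ true

deg : ∀ {n} → Graph n → Fin n → ℕ
deg {n} G v = sum (map (λ u → if adj G v u then 1 else 0) (allFin n))

sdeg : ∀ {n} → Graph n → Fin n → ℕ
sdeg {n} G v = sum (map (λ u → if adj G v u then deg G u else 0) (allFin n))

edgeCount : ∀ {n} → Graph n → ℕ
edgeCount {n} G =
  sum (concatMap (λ u → map (λ v →
        if does (toℕ u <? toℕ v) then (if adj G u v then 1 else 0) else 0)
        (allFin n)) (allFin n))

Connected : ∀ {n} → Graph n → Set
Connected G = ∀ u v → Star (Adj G) u v

Bicyclic : ∀ {n} → Graph n → Set
Bicyclic {n} G = Connected G × (edgeCount G ≡ n + 1)

ParabolicWith : ∀ {n} → Graph n → ℕ → ℕ → Set
ParabolicWith G a b =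
  (1 ≤ a) × (8 * b < a * a) ×
  (∀ v → + sdeg G v ≡ (ℤ.- (+ deg G v ℤ.* + deg G v)) ℤ.+ (+ a ℤ.* + deg G v) ℤ.- + b)

TwoWalkParabolic : ∀ {n} → Graph n → ℕ → ℕ → Set
TwoWalkParabolic G a b =
  ParabolicWith G a b × (∀ a' b' → ParabolicWith G a' b' → (a' ≡ a) × (b' ≡ b))

MinDegOne : ∀ {n} → Graph n → Set
MinDegOne G = (∀ v → 1 ≤ deg G v) × (∃[ v ] deg G v ≡ 1)

InGab : ∀ {n} → ℕ → ℕ → Graph n → Set
InGab a b G = TwoWalkParabolic G a b × Bicyclic G × MinDegOne G

-- degree in G₀ (G with all pendant vertices deleted):
-- number of neighbours of v that are not pendant in G
deg₀ : ∀ {n} → Graph n → Fin n → ℕ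
deg₀ {n} G v = sum (map (λ u →
  if adj G v u then (if does (1 <? deg G u) then 1 else 0) else 0) (allFin n))

-- A cycle u_1 u_2 ... u_k u_1 (k ≥ 3), indexed by Fin k (index 0 = u_1):
-- distinct vertices, consecutive ones adjacent, and u_k adjacent to u_1.
record Cycle {n} (G : Graph n) (k : ℕ) : Set where
  field
    len≥3   : 3 ≤ k
    vert    : Fin k → Fin n
    inj     : ∀ i j → vert i ≡ vert j → i ≡ j
    step    : ∀ i j → toℕ j ≡ suc (toℕ i) → Adj G (vert i) (vert j)
    close   : ∀ i j → toℕ i ≡ k ∸ 1 → toℕ j ≡ 0 → Adj G (vert i) (vert j)
open Cycle public

-- The value a − b − 1 plays no role: we show that the four
-- consecutive cycle vertices u_k, u₁, u₂, u₃ cannot all have one common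
-- degree D.  Since s is a function of d in a parabolic graph, equal
-- degrees force s(u₁) = s(u₂).  But, with minimum degree 1, a vertex v
-- with two distinct neighbours x, y satisfies
--     d(x) + d(y) + d(v) + d_{G₀}(v) ≤ s(v) + 4,
-- while if x, y are non-pendant and d_{G₀}(v) = 2 (all other neighbours
-- are pendant) then s(v) + 2 ≤ d(x) + d(y) + d(v).  Applied to u₁ (with
-- u₂, u_k) and u₂ (with u₁, u₃) this gives s(u₂) + 2 ≤ 3D ≤ s(u₁) + 1.
module Submission where

open import Defs
open import Data.Nat using (ℕ; zero; suc)
open import Data.Fin using (Fin; toℕ)
open import Data.Product using (∃-syntax)
open import Data.Integer as ℤ using (+_)
open import Relation.Nullary using (¬_)
open import Relation.Binary.PropositionalEquality using (_≡_)

open import Data.Nat using (_+_; _∸_; _≤_; _<_; z≤n; s≤s; _<?_; _<ᵇ_)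
open import Data.Nat.Properties hiding (_≟_)
open import Data.Nat.Tactic.RingSolver using (solve-∀)
import Data.Fin as F using (zero; suc; fromℕ<)
open import Data.Fin.Properties using (_≟_; toℕ-fromℕ<)
import Data.Integer.Properties as ℤ
open import Data.Bool using (Bool; true; false; if_then_else_; _∨_)
open import Data.Bool.Properties using (∨-identityʳ)
open import Data.List using (List; []; _∷_; map; allFin; tabulate)
open import Data.List.Properties using (map-tabulate)
open import Data.List.Relation.Unary.All using (All; []; _∷_)
open import Data.List.Relation.Unary.All.Properties using (¬All⇒Any¬)
open import Data.List.Relation.Unary.Any using (satisfied)
open import Data.Nat.ListAction using (sum)
open import Data.Product using (_,_)
open import Data.Empty using (⊥)
open import Relation.Nullary using (does; contradiction)
open import Relation.Nullary.Reflects using (ofʸ; ofⁿ)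
open import Relation.Nullary.Decidable using (dec-false)
open import Relation.Binary.PropositionalEquality
  using (refl; sym; trans; cong; cong₂; subst; subst₂; module ≡-Reasoning)
open import Function using (id; _∘_)
open import Algebra.Properties.CommutativeMonoid.Sum +-0-commutativeMonoid
  using (∑-distrib-+; sum-cong-≗) renaming (sum to ∑)

sum-tabulate : ∀ {n} (h : Fin n → ℕ) → sum (tabulate h) ≡ ∑ h
sum-tabulate {zero}  h = refl
sum-tabulate {suc n} h = cong (_+_ (h F.zero)) (sum-tabulate (h ∘ F.suc))

∑-mono-≤ : ∀ {n} {f g : Fin n → ℕ} → (∀ u → f u ≤ g u) → ∑ f ≤ ∑ g
∑-mono-≤ {zero}  f≤g = z≤n
∑-mono-≤ {suc n} f≤g = +-mono-≤ (f≤g F.zero) (∑-mono-≤ (f≤g ∘ F.suc))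

∑≡0⇒≡0 : ∀ {n} (h : Fin n → ℕ) → ∑ h ≡ 0 → ∀ u → h u ≡ 0
∑≡0⇒≡0 h eq F.zero    = m+n≡0⇒m≡0 (h F.zero) eq
∑≡0⇒≡0 h eq (F.suc u) = ∑≡0⇒≡0 (h ∘ F.suc) (m+n≡0⇒n≡0 (h F.zero) eq) u

∑-mono-≤-off : ∀ {n} (c : Fin n → ℕ) {f g : Fin n → ℕ} →
  (∀ u → c u ≡ 0 → f u ≤ g u) → ∑ c ≡ 0 → ∑ f ≤ ∑ g
∑-mono-≤-off c f≤g c≡0 = ∑-mono-≤ (λ u → f≤g u (∑≡0⇒≡0 c c≡0 u))

mask : ∀ {n} → (Fin n → Bool) → (Fin n → ℕ) → Fin n → ℕ
mask p h u = if p u then 0 else h u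

at : ∀ {n} → Fin n → Fin n → Bool
at x u = does (u ≟ x)

∑-unmask : ∀ {n} (p : Fin n → Bool) (h : Fin n → ℕ) x → p x ≡ false →
  ∑ (mask p h) ≡ h x + ∑ (mask (λ u → at x u ∨ p u) h)
∑-unmask {suc n} p h F.zero px rewrite px = refl
∑-unmask {suc n} p h (F.suc x) px = begin
    mask p h F.zero + ∑ (mask (p ∘ F.suc) (h ∘ F.suc))
  ≡⟨ cong (_+_ (mask p h F.zero)) (∑-unmask (p ∘ F.suc) (h ∘ F.suc) x px) ⟩
    mask p h F.zero + (h (F.suc x) + ∑ rest)
  ≡⟨ +-comm-middle (mask p h F.zero) (h (F.suc x)) (∑ rest) ⟩
    h (F.suc x) + (mask p h F.zero + ∑ rest)
  ∎
  where
  open ≡-Reasoning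
  rest : Fin n → ℕ
  rest = mask (λ u → at x u ∨ p (F.suc u)) (h ∘ F.suc)
  +-comm-middle : ∀ a b c → a + (b + c) ≡ b + (a + c)
  +-comm-middle = solve-∀

pair : ∀ {n} → Fin n → Fin n → Fin n → Bool
pair x y u = at y u ∨ at x u

∑-split₂ : ∀ {n} (h : Fin n → ℕ) {x y} → ¬ y ≡ x →
  ∑ h ≡ h x + h y + ∑ (mask (pair x y) h)
∑-split₂ h {x} {y} y≢x = begin
    ∑ h
  ≡⟨ ∑-unmask (λ _ → false) h x refl ⟩
    h x + ∑ (mask (λ u → at x u ∨ false) h)
  ≡⟨ cong (_+_ (h x)) (sum-cong-≗ (λ u → cong (λ b → if b then 0 else h u) (∨-identityʳ (at x u)))) ⟩
    h x + ∑ (mask (at x) h)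
  ≡⟨ cong (_+_ (h x)) (∑-unmask (at x) h y (dec-false (y ≟ x) y≢x)) ⟩
    h x + (h y + ∑ (mask (pair x y) h))
  ≡⟨ sym (+-assoc (h x) (h y) _) ⟩
    h x + h y + ∑ (mask (pair x y) h)
  ∎ where open ≡-Reasoning

module Neighbourhoods {n : ℕ} (G : Graph n) where

  -- t restricted to the neighbours of v; d(v), s(v) and d_{G₀}(v) are the
  -- sums of such functions for t = 1, t = d and t = nonPendant.
  onNbrs : Fin n → (Fin n → ℕ) → Fin n → ℕ
  onNbrs v t u = if adj G v u then t u else 0

  nonPendant : Fin n → ℕ
  nonPendant u = if does (1 <? deg G u) then 1 else 0

  others : Fin n → Fin n → Fin n → (Fin n → ℕ) → ℕ
  others v x y t = ∑ (mask (pair x y) (onNbrs v t))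

  split-nbrs : ∀ {v x y} → Adj G v x → Adj G v y → ¬ y ≡ x → ∀ t →
    sum (map (onNbrs v t) (allFin n)) ≡ t x + t y + others v x y t
  split-nbrs {v} {x} {y} vx vy y≢x t = begin
      sum (map (onNbrs v t) (allFin n))
    ≡⟨ cong sum (map-tabulate id (onNbrs v t)) ⟩
      sum (tabulate (onNbrs v t))
    ≡⟨ sum-tabulate (onNbrs v t) ⟩
      ∑ (onNbrs v t)
    ≡⟨ ∑-split₂ (onNbrs v t) y≢x ⟩
      onNbrs v t x + onNbrs v t y + others v x y t
    ≡⟨ cong₂ (λ tx ty → tx + ty + others v x y t) (onNbr vx) (onNbr vy) ⟩
      t x + t y + others v x y t
    ∎
    where
    open ≡-Reasoning
    onNbr : ∀ {u} → Adj G v u → onNbrs v t u ≡ t u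
    onNbr vu rewrite vu = refl

  others-+ : ∀ v x y {t₁ t₂ t₃ : Fin n → ℕ} → (∀ u → t₁ u + t₂ u ≤ t₃ u) →
    others v x y t₁ + others v x y t₂ ≤ others v x y t₃
  others-+ v x y {t₁} {t₂} {t₃} t≤ =
    ≤-trans (≤-reflexive (sym (∑-distrib-+ (mask (pair x y) (onNbrs v t₁)) _)))
            (∑-mono-≤ pointwise)
    where
    pointwise : ∀ u → mask (pair x y) (onNbrs v t₁) u + mask (pair x y) (onNbrs v t₂) u
                      ≤ mask (pair x y) (onNbrs v t₃) u
    pointwise u with pair x y u | adj G v u
    ... | true  | _     = z≤n
    ... | false | false = z≤n
    ... | false | true  = t≤ u

  others-≤-off : ∀ v x y {t₀ t₁ t₂ : Fin n → ℕ} → (∀ u → t₀ u ≡ 0 → t₁ u ≤ t₂ u) →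
    others v x y t₀ ≡ 0 → others v x y t₁ ≤ others v x y t₂
  others-≤-off v x y {t₀} {t₁} {t₂} t≤ =
    ∑-mono-≤-off (mask (pair x y) (onNbrs v t₀)) pointwise
    where
    pointwise : ∀ u → mask (pair x y) (onNbrs v t₀) u ≡ 0 →
      mask (pair x y) (onNbrs v t₁) u ≤ mask (pair x y) (onNbrs v t₂) u
    pointwise u with pair x y u | adj G v u
    ... | true  | _     = λ _ → z≤n
    ... | false | false = λ _ → z≤n
    ... | false | true  = t≤ u

  -- The test `does (1 <? d)` in nonPendant computes to `1 <ᵇ d`, so the
  -- four facts below analyse it via `<ᵇ-reflects-<`.
  nonPendant≤1 : ∀ u → nonPendant u ≤ 1
  nonPendant≤1 u with 1 <ᵇ deg G u | <ᵇ-reflects-< 1 (deg G u)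
  ... | true  | _ = ≤-refl
  ... | false | _ = z≤n

  nonPendant-of-1< : ∀ {u} → 1 < deg G u → nonPendant u ≡ 1
  nonPendant-of-1< {u} 1<d with 1 <ᵇ deg G u | <ᵇ-reflects-< 1 (deg G u)
  ... | true  | _       = refl
  ... | false | ofⁿ 1≮d = contradiction 1<d 1≮d

  pendant-deg : ∀ u → nonPendant u ≡ 0 → deg G u ≤ 1
  pendant-deg u with 1 <ᵇ deg G u | <ᵇ-reflects-< 1 (deg G u)
  ... | true  | _       = λ ()
  ... | false | ofⁿ 1≮d = λ _ → ≮⇒≥ 1≮d

  deg-nonPendant : (∀ w → 1 ≤ deg G w) → ∀ u → 1 + nonPendant u ≤ deg G u
  deg-nonPendant minDeg u with 1 <ᵇ deg G u | <ᵇ-reflects-< 1 (deg G u)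
  ... | true  | ofʸ 1<d = 1<d
  ... | false | _       = minDeg u

  1<deg : ∀ {v x y} → Adj G v x → Adj G v y → ¬ y ≡ x → 1 < deg G v
  1<deg {v} {x} {y} vx vy y≢x =
    ≤-trans (m≤m+n 2 _) (≤-reflexive (sym (split-nbrs vx vy y≢x (λ _ → 1))))

  sdeg-lower : (∀ w → 1 ≤ deg G w) → ∀ {v x y} → Adj G v x → Adj G v y → ¬ y ≡ x →
    deg G x + deg G y + deg G v + deg₀ G v ≤ sdeg G v + 4
  sdeg-lower minDeg {v} {x} {y} vx vy y≢x = begin
      dx + dy + deg G v + deg₀ G v
    ≡⟨ cong₂ (λ d d₀ → dx + dy + d + d₀) (split (λ _ → 1)) (split nonPendant) ⟩
      dx + dy + (2 + r₁) + (nonPendant x + nonPendant y + r₀)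
    ≤⟨ +-monoʳ-≤ (dx + dy + (2 + r₁))
         (+-monoˡ-≤ r₀ (+-mono-≤ (nonPendant≤1 x) (nonPendant≤1 y))) ⟩
      dx + dy + (2 + r₁) + (2 + r₀)
    ≡⟨ regroup dx dy r₁ r₀ ⟩
      dx + dy + (r₁ + r₀) + 4
    ≤⟨ +-monoˡ-≤ 4 (+-monoʳ-≤ (dx + dy)
         (others-+ v x y (deg-nonPendant minDeg))) ⟩
      dx + dy + others v x y (deg G) + 4
    ≡⟨ cong (_+ 4) (sym (split (deg G))) ⟩
      sdeg G v + 4
    ∎
    where
    open ≤-Reasoning
    split : ∀ t → sum (map (onNbrs v t) (allFin n)) ≡ t x + t y + others v x y t
    split = split-nbrs vx vy y≢x
    dx dy r₁ r₀ : ℕ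
    dx = deg G x
    dy = deg G y
    r₁ = others v x y (λ _ → 1)
    r₀ = others v x y nonPendant
    regroup : ∀ a b c d → a + b + (2 + c) + (2 + d) ≡ a + b + (c + d) + 4
    regroup = solve-∀

  sdeg-upper : ∀ {v x y} → Adj G v x → Adj G v y → ¬ y ≡ x →
    1 < deg G x → 1 < deg G y → deg₀ G v ≡ 2 →
    sdeg G v + 2 ≤ deg G x + deg G y + deg G v
  sdeg-upper {v} {x} {y} vx vy y≢x 1<dx 1<dy d₀v≡2 = begin
      sdeg G v + 2
    ≡⟨ cong (_+ 2) (split (deg G)) ⟩
      dx + dy + others v x y (deg G) + 2
    ≤⟨ +-monoˡ-≤ 2 (+-monoʳ-≤ (dx + dy)
         (others-≤-off v x y pendant-deg others-nonPendant≡0)) ⟩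
      dx + dy + r₁ + 2
    ≡⟨ regroup dx dy r₁ ⟩
      dx + dy + (2 + r₁)
    ≡⟨ cong (_+_ (dx + dy)) (sym (split (λ _ → 1))) ⟩
      dx + dy + deg G v
    ∎
    where
    open ≤-Reasoning
    split : ∀ t → sum (map (onNbrs v t) (allFin n)) ≡ t x + t y + others v x y t
    split = split-nbrs vx vy y≢x
    dx dy r₁ : ℕ
    dx = deg G x
    dy = deg G y
    r₁ = others v x y (λ _ → 1)
    others-nonPendant≡0 : others v x y nonPendant ≡ 0
    others-nonPendant≡0 = +-cancelˡ-≡ 2 _ 0 (begin-equality
      2 + others v x y nonPendant
        ≡⟨ cong₂ (λ px py → px + py + others v x y nonPendant)
             (nonPendant-of-1< 1<dx) (nonPendant-of-1< 1<dy) ⟨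
      nonPendant x + nonPendant y + others v x y nonPendant
        ≡⟨ sym (split nonPendant) ⟩
      deg₀ G v
        ≡⟨ d₀v≡2 ⟩
      2 ∎)
    regroup : ∀ a b c → a + b + c + 2 ≡ a + b + (2 + c)
    regroup = solve-∀

  sdeg-gap : (∀ w → 1 ≤ deg G w) → ∀ {uₖ u₁ u₂ u₃} →
    Adj G u₁ u₂ → Adj G u₁ uₖ → ¬ uₖ ≡ u₂ → Adj G u₂ u₃ → ¬ u₃ ≡ u₁ →
    3 ≤ deg₀ G u₁ → deg₀ G u₂ ≡ 2 →
    deg G u₂ ≡ deg G u₁ → deg G u₃ ≡ deg G u₁ → deg G uₖ ≡ deg G u₁ →
    sdeg G u₂ < sdeg G u₁
  sdeg-gap minDeg {uₖ} {u₁} {u₂} {u₃} a₁₂ a₁ₖ uₖ≢u₂ a₂₃ u₃≢u₁ d₀u₁≥3 d₀u₂≡2 e₂ e₃ eₖ =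
    +-cancelˡ-≤ 4 _ _ (begin
      4 + suc (sdeg G u₂)
        ≡⟨ regroup (sdeg G u₂) ⟩
      sdeg G u₂ + 2 + 3
        ≤⟨ +-monoˡ-≤ 3 upper ⟩
      D + D + D + 3
        ≤⟨ +-monoʳ-≤ (D + D + D) d₀u₁≥3 ⟩
      D + D + D + deg₀ G u₁
        ≤⟨ lower ⟩
      sdeg G u₁ + 4
        ≡⟨ +-comm (sdeg G u₁) 4 ⟩
      4 + sdeg G u₁ ∎)
    where
    open ≤-Reasoning
    D : ℕ
    D = deg G u₁
    a₂₁ : Adj G u₂ u₁
    a₂₁ = trans (adj-sym G u₂ u₁) a₁₂
    1<D : 1 < D
    1<D = 1<deg a₁₂ a₁ₖ uₖ≢u₂
    lower : D + D + D + deg₀ G u₁ ≤ sdeg G u₁ + 4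
    lower = subst₂ _≤_ (cong₂ (λ d₂ dₖ → d₂ + dₖ + D + deg₀ G u₁) e₂ eₖ) refl
              (sdeg-lower minDeg a₁₂ a₁ₖ uₖ≢u₂)
    upper : sdeg G u₂ + 2 ≤ D + D + D
    upper = subst₂ _≤_ refl (cong₂ (λ d₃ d₂ → D + d₃ + d₂) e₃ e₂)
              (sdeg-upper a₂₁ a₂₃ u₃≢u₁ 1<D (subst (1 <_) (sym e₃) 1<D) d₀u₂≡2)
    regroup : ∀ s → 4 + suc s ≡ s + 2 + 3
    regroup = solve-∀

open Neighbourhoods using (sdeg-gap)

parabolic-sdeg : ∀ {n} {G : Graph n} {a b} → ParabolicWith G a b →
  ∀ {v w} → deg G v ≡ deg G w → sdeg G v ≡ sdeg G w
parabolic-sdeg {a = a} {b} (_ , _ , law) {v} {w} dv≡dw =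
  ℤ.+-injective (trans (law v) (trans (cong parabola dv≡dw) (sym (law w))))
  where
  parabola : ℕ → ℤ.ℤ
  parabola d = (ℤ.- (+ d ℤ.* + d)) ℤ.+ (+ a ℤ.* + d) ℤ.- + b

module _ {n k : ℕ} {G : Graph n} (C : Cycle G k) where

  private
    k∸1<k : k ∸ 1 < k
    k∸1<k with len≥3 C
    ... | s≤s _ = ≤-refl

  third lastIx : Fin k
  third  = F.fromℕ< (len≥3 C)
  lastIx = F.fromℕ< k∸1<k

  toℕ-third : toℕ third ≡ 2
  toℕ-third = toℕ-fromℕ< (len≥3 C)

  toℕ-lastIx : toℕ lastIx ≡ k ∸ 1
  toℕ-lastIx = toℕ-fromℕ< k∸1<k

  cycle-distinct : ∀ {i j} → ¬ toℕ i ≡ toℕ j → ¬ vert C i ≡ vert C j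
  cycle-distinct {i} {j} i≢j eq = i≢j (cong toℕ (inj C i j eq))

  k∸1≢1 : ¬ k ∸ 1 ≡ 1
  k∸1≢1 with len≥3 C
  ... | s≤s (s≤s (s≤s _)) = λ ()

window-not-regular : ∀ {n a b k} {G : Graph n} → ParabolicWith G a b →
  (∀ w → 1 ≤ deg G w) → (C : Cycle G k) (i₁ i₂ : Fin k) →
  toℕ i₁ ≡ 0 → toℕ i₂ ≡ 1 →
  3 ≤ deg₀ G (vert C i₁) → deg₀ G (vert C i₂) ≡ 2 →
  deg G (vert C i₂) ≡ deg G (vert C i₁) →
  deg G (vert C (third C)) ≡ deg G (vert C i₁) →
  deg G (vert C (lastIx C)) ≡ deg G (vert C i₁) → ⊥
window-not-regular {n} {G = G} parabolic minDeg C i₁ i₂ t₁ t₂ d₀u₁ d₀u₂ e₂ e₃ eₖ =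
  <-irrefl (parabolic-sdeg {G = G} parabolic e₂)
    (sdeg-gap G minDeg a₁₂ a₁ₖ uₖ≢u₂ a₂₃ u₃≢u₁ d₀u₁ d₀u₂ e₂ e₃ eₖ)
  where
  u₁ u₂ u₃ uₖ : Fin n
  u₁ = vert C i₁
  u₂ = vert C i₂
  u₃ = vert C (third C)
  uₖ = vert C (lastIx C)
  a₁₂ : Adj G u₁ u₂
  a₁₂ = step C i₁ i₂ (trans t₂ (cong suc (sym t₁)))
  a₂₃ : Adj G u₂ u₃
  a₂₃ = step C i₂ (third C) (trans (toℕ-third C) (cong suc (sym t₂)))
  a₁ₖ : Adj G u₁ uₖ
  a₁ₖ = trans (adj-sym G u₁ uₖ) (close C (lastIx C) i₁ (toℕ-lastIx C) t₁)
  uₖ≢u₂ : ¬ uₖ ≡ u₂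
  uₖ≢u₂ = cycle-distinct C (λ eq → k∸1≢1 C (trans (sym (toℕ-lastIx C)) (trans eq t₂)))
  u₃≢u₁ : ¬ u₃ ≡ u₁
  u₃≢u₁ = cycle-distinct C (λ eq → 2≢0 (trans (sym (toℕ-third C)) (trans eq t₁)))
    where
    2≢0 : ¬ 2 ≡ 0
    2≢0 ()

lemma4 : ∀ (a b : ℕ) {n : ℕ} (G : Graph n) → InGab a b G →
    ∀ (k : ℕ) (C : Cycle G k) (i₁ i₂ : Fin k) → toℕ i₁ ≡ 0 → toℕ i₂ ≡ 1 →
    3 Data.Nat.≤ deg₀ G (vert C i₁) → deg₀ G (vert C i₂) ≡ 2 →
    ∃[ i ] ¬ (+ deg G (vert C i) ≡ + a ℤ.- + b ℤ.- + 1)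
-- By decidability, one of u₁, u₂, u₃, u_k has degree ≠ a − b − 1, since
-- otherwise these four degrees would coincide.
lemma4 a b G ((parabolic , _) , _ , (minDeg , _)) k C i₁ i₂ t₁ t₂ d₀u₁ d₀u₂ =
  satisfied (¬All⇒Any¬ (λ i → + deg G (vert C i) ℤ.≟ target) window notAll)
  where
  target : ℤ.ℤ
  target = + a ℤ.- + b ℤ.- + 1
  window : List (Fin k)
  window = i₁ ∷ i₂ ∷ third C ∷ lastIx C ∷ []
  notAll : ¬ All (λ i → + deg G (vert C i) ≡ target) window
  notAll (p₁ ∷ p₂ ∷ p₃ ∷ pₖ ∷ []) =
    window-not-regular parabolic minDeg C i₁ i₂ t₁ t₂ d₀u₁ d₀u₂
      (sameAs₁ p₂) (sameAs₁ p₃) (sameAs₁ pₖ)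
    where
    sameAs₁ : ∀ {i} → + deg G (vert C i) ≡ target → deg G (vert C i) ≡ deg G (vert C i₁)
    sameAs₁ p = ℤ.+-injective (trans p (sym p₁))
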